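{- Every caterpillar whose maximum vertex degree is at most $5$ is odd prime.
   Context: All graphs are finite and simple. An odd prime labeling of a graph $G$ with $N$ vertices is a bijection $\ell:V(G)\to\{1,3,\dots,2N-1\}$ such that $\gcd(\ell(u),\ell(v))=1$ for every edge $uv$; $G$ is odd prime if it has one. A caterpillar is a tree containing a path $v_1,v_2,\dots,v_n$ (the spine) such that every vertex not on the spine is a leaf adjacent to one of the interior spine vertices $v_2,\dots,v_{n-1}$. -}

module Defs where

open import Data.Nat using (ℕ; _+_; _*_; _≤_; _<_)
open import Data.Nat.Coprimality using (Coprime)
open import Data.Fin using (Fin; toℕ; fromℕ; inject₁; zero; suc)
open import Data.Fin.Properties using ()
open import Data.Bool using (Bool; true; false)
open import Data.List using (List; length; filterᵇ; allFin)
open import Data.Product using (Σ; ∃; _×_; _,_)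
open import Data.Sum using (_⊎_)
open import Relation.Binary.PropositionalEquality using (_≡_)
open import Relation.Nullary using (¬_)
open import Function.Definitions using (Injective; Bijective)

record Graph : Set where
  field
    N      : ℕ
    adj    : Fin N → Fin N → Bool
    sym    : ∀ u v → adj u v ≡ adj v u
    irrefl : ∀ v → adj v v ≡ false
open Graph public

Adj : (G : Graph) → Fin (N G) → Fin (N G) → Set
Adj G u v = adj G u v ≡ true

degree : (G : Graph) → Fin (N G) → ℕ
degree G v = length (filterᵇ (adj G v) (allFin (N G)))

maxDegree≤ : Graph → ℕ → Set
maxDegree≤ G d = ∀ v → degree G v ≤ d

data Reach (G : Graph) : Fin (N G) → Fin (N G) → Set where
  here : ∀ {v} → Reach G v v
  step : ∀ {u v w} → Adj G u v → Reach G v w → Reach G u w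

Connected : Graph → Set
Connected G = ∀ u v → Reach G u v

record Cycle (G : Graph) : Set where
  field
    k      : ℕ
    c      : Fin (3 + k) → Fin (N G)
    inj    : Injective _≡_ _≡_ c
    consec : ∀ (i : Fin (2 + k)) → Adj G (c (inject₁ i)) (c (suc i))
    close  : Adj G (c (fromℕ (2 + k))) (c zero)

Acyclic : Graph → Set
Acyclic G = ¬ Cycle G

Tree : Graph → Set
Tree G = (0 < N G) × Connected G × Acyclic G

-- a path v_1, …, v_n in G (n ≥ 1), given as an injective map s : Fin n → V
-- with consecutive vertices adjacent (0-indexed: s 0 = v_1, …, s (n-1) = v_n)
record Spine (G : Graph) : Set where
  field
    n      : ℕ
    s      : Fin (1 + n) → Fin (N G)
    inj    : Injective _≡_ _≡_ s
    consec : ∀ (i : Fin n) → Adj G (s (inject₁ i)) (s (suc i))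

-- interior spine index: i ∉ {0, n} (i.e. v_2, …, v_{n-1} in 1-indexed terms)
Interior : ∀ {G} → (P : Spine G) → Fin (1 + Spine.n P) → Set
Interior P i = 0 < toℕ i × toℕ i < Spine.n P

Caterpillar : Graph → Set
Caterpillar G = Tree G × Σ (Spine G) λ P →
  ∀ v → (∀ i → ¬ (Spine.s P i ≡ v)) →
    degree G v ≡ 1 × ∃ λ i → Interior P i × Adj G (Spine.s P i) v

oddLabel : ∀ {N} → Fin N → ℕ
oddLabel k = 1 + 2 * toℕ k

-- odd prime labeling: a bijection V → {1,3,…,2N-1} (encoded as a bijection
-- f : Fin N → Fin N composed with oddLabel) with adjacent labels coprime
OddPrimeLabeling : Graph → Set
OddPrimeLabeling G = Σ (Fin (N G) → Fin (N G)) λ f →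
  Bijective _≡_ _≡_ f ×
  (∀ u v → Adj G u v → Coprime (oddLabel (f u)) (oddLabel (f v)))

OddPrime : Graph → Set
OddPrime G = OddPrimeLabeling G

-- Lay the vertices out in a row and give the vertex at position p the label 2p + 1.  A common
-- divisor of 2p + 1 and 2q + 1 is odd and divides 2(q - p), so the labels of an edge are coprime
-- as soon as one end sits at position 0 or the two ends are a power of two apart.  Spine vertex 1
-- goes to position 0; then the end vertex 0 and the leaves of vertex 1 may go anywhere.  The
-- remaining spine vertices are laid out from left to right by a finite automaton that reads the
-- number (at most 3, by the degree bound) of leaves of the next spine vertex and sometimes defers
-- two leaves of the current one.  An invariant on the prefix laid out so far shows that a new
-- token can only be joined to an old one through the current spine vertex, so each of the
-- finitely many moves is verified once and for all by evaluating Boolean checks on it.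

module Submission where

open import Defs hiding (sym)

open import Data.Bool using (Bool; true; false; _∧_; _∨_; not; T)
import Data.Bool as Bool
open import Data.Bool.ListAction using (all)
open import Data.Bool.Properties using (T-∧; T-∨; T-≡)
open import Data.Empty using (⊥; ⊥-elim)
open import Data.Fin using (Fin; toℕ; fromℕ; fromℕ<; inject₁; zero; suc; cast) renaming (_≟_ to _≟ᶠ_)
open import Data.Fin.Properties
  using (toℕ-injective; toℕ-fromℕ<; toℕ≤pred[n]; toℕ-inject₁; toℕ-fromℕ; toℕ<n; toℕ-cast; injective⇒≤; any?)
open import Data.List using (List; []; _∷_; _++_; map; length; upTo; lookup; filter; filterᵇ; allFin)
open import Data.List.Properties using (length-++; length-map; ++-assoc; map-++; map-∘)
open import Data.List.Membership.Propositional using (_∈_)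
open import Data.List.Membership.Propositional.Properties
  using (∈-map⁺; ∈-map⁻; ∈-upTo⁺; ∈-upTo⁻; ∈-++⁺ˡ; ∈-++⁺ʳ; ∈-++⁻; ∈-∃++; ∈-filter⁺; ∈-filter⁻; ∈-allFin; ∈-lookup)
open import Data.List.Relation.Binary.Permutation.Propositional
  using (_↭_; prep; swap; ↭-refl; ↭-sym; ↭-trans; ↭⇒↭ₛ; module PermutationReasoning)
open import Data.List.Relation.Binary.Permutation.Propositional.Properties using (++⁺ˡ; ++⁺ʳ; shift; ++-comm; ∈-resp-↭)
import Data.List.Relation.Binary.Permutation.Propositional.Properties as ↭
open import Data.List.Relation.Binary.Subset.Propositional using (_⊆_)
open import Data.List.Relation.Unary.All using (All)
import Data.List.Relation.Unary.All as All
open import Data.List.Relation.Unary.All.Properties using (all⁺)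
open import Data.List.Relation.Unary.AllPairs using ([]; _∷_)
import Data.List.Relation.Unary.Any as Any
open import Data.List.Relation.Unary.Unique.Propositional using (Unique)
import Data.List.Relation.Unary.Unique.Propositional.Properties as Unique
open import Data.Maybe using (Maybe; just; nothing; maybe)
import Data.Maybe as Maybe
open import Data.Nat
  using (ℕ; zero; suc; _+_; _*_; _^_; _∸_; _≤_; _<_; z≤n; s≤s; _≡ᵇ_; _≤ᵇ_; _<ᵇ_; _≟_; _≤?_; _<?_)
open import Data.Nat.Properties
open import Data.Nat.Coprimality using (Coprime; coprime-+; coprime-divisor; 1-coprimeTo) renaming (sym to coprime-sym)
open import Data.Nat.Divisibility using (_∣_; ∣-trans; ∣m+n∣m⇒∣n)
open import Data.Product using (∃; ∃-syntax; _×_; _,_; proj₁; proj₂)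
open import Data.Sum using (_⊎_; inj₁; inj₂)
open import Data.Unit using (⊤; tt)
open import Function using (_∘_; Equivalence)
open import Function.Definitions using (Injective; Surjective)
open import Relation.Binary.Definitions using (DecidableEquality; tri<; tri≈; tri>)
open import Relation.Binary.PropositionalEquality
  using (_≡_; _≢_; refl; sym; trans; cong; cong₂; subst; subst₂; setoid; module ≡-Reasoning)
open import Relation.Nullary using (¬_; Dec; yes; no; ¬?)
open import Relation.Nullary.Decidable using (map′; _×-dec_; T?)
open import Relation.Unary using (Decidable)

open Equivalence using (to; from)

-- Powers of two and odd numbers

IsPow2 : ℕ → Set
IsPow2 d = ∃[ e ] d ≡ 2 ^ e

coprime-∣ˡ : ∀ {d m n} → d ∣ m → Coprime m n → Coprime d n
coprime-∣ˡ d∣m cop (i∣d , i∣n) = cop (∣-trans i∣d d∣m , i∣n)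

coprime-*ʳ : ∀ {m n o} → Coprime m n → Coprime m o → Coprime m (n * o)
coprime-*ʳ m⊥n m⊥o (i∣m , i∣no) = m⊥o (i∣m , coprime-divisor (coprime-∣ˡ i∣m m⊥n) i∣no)

odd-coprime-2 : ∀ p → Coprime (1 + 2 * p) 2
odd-coprime-2 zero    = 1-coprimeTo 2
odd-coprime-2 (suc p) =
  subst (λ m → Coprime m 2) (cong suc (sym (*-distribˡ-+ 2 1 p))) (coprime-+ (odd-coprime-2 p))

odd-coprime-2^ : ∀ p e → Coprime (1 + 2 * p) (2 ^ e)
odd-coprime-2^ p zero    = coprime-sym (1-coprimeTo _)
odd-coprime-2^ p (suc e) = coprime-*ʳ (odd-coprime-2 p) (odd-coprime-2^ p e)

odd-coprime-pow2-apart : ∀ {p q} → p ≤ q → IsPow2 (q ∸ p) → Coprime (1 + 2 * p) (1 + 2 * q)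
odd-coprime-pow2-apart {p} {q} p≤q (e , q∸p≡2^e) {i} (i∣1+2p , i∣1+2q) =
  odd-coprime-2^ p (suc e) (i∣1+2p , ∣m+n∣m⇒∣n (subst (i ∣_) split i∣1+2q) i∣1+2p)
  where
  open ≡-Reasoning
  split : 1 + 2 * q ≡ (1 + 2 * p) + 2 ^ suc e
  split = cong suc (begin
    2 * q                 ≡⟨ cong (2 *_) (sym (m+[n∸m]≡n p≤q)) ⟩
    2 * (p + (q ∸ p))     ≡⟨ *-distribˡ-+ 2 p (q ∸ p) ⟩
    2 * p + 2 * (q ∸ p)   ≡⟨ cong (λ d → 2 * p + 2 * d) q∸p≡2^e ⟩
    2 * p + 2 ^ suc e     ∎)

WellSpaced : ℕ → ℕ → Set
WellSpaced p q = p ≡ 0 ⊎ IsPow2 (q ∸ p)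

wellSpaced-coprime : ∀ {p q} → p < q → WellSpaced p q → Coprime (1 + 2 * p) (1 + 2 * q)
wellSpaced-coprime p<q (inj₁ refl) = 1-coprimeTo _
wellSpaced-coprime p<q (inj₂ pow2) = odd-coprime-pow2-apart (<⇒≤ p<q) pow2

infix 4 _[_]=_

data _[_]=_ {A : Set} : List A → ℕ → A → Set where
  here  : ∀ {x xs} → (x ∷ xs) [ 0 ]= x
  there : ∀ {x xs p y} → xs [ p ]= y → (x ∷ xs) [ suc p ]= y

module _ {A : Set} where

  []=⇒< : ∀ {xs : List A} {p x} → xs [ p ]= x → p < length xs
  []=⇒< here      = s≤s z≤n
  []=⇒< (there h) = s≤s ([]=⇒< h)

  []=-++⁻ : ∀ (xs : List A) {ys p x} → (xs ++ ys) [ p ]= x →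
            xs [ p ]= x ⊎ ∃[ o ] p ≡ length xs + o × ys [ o ]= x
  []=-++⁻ []       h         = inj₂ (_ , refl , h)
  []=-++⁻ (y ∷ xs) here      = inj₁ here
  []=-++⁻ (y ∷ xs) (there h) with []=-++⁻ xs h
  ... | inj₁ h′            = inj₁ (there h′)
  ... | inj₂ (o , eq , h′) = inj₂ (o , cong suc eq , h′)

  []=⇒∈ : ∀ {xs : List A} {p x} → xs [ p ]= x → x ∈ xs
  []=⇒∈ here      = Any.here refl
  []=⇒∈ (there h) = Any.there ([]=⇒∈ h)

  []=-functional : ∀ {xs : List A} {p x y} → xs [ p ]= x → xs [ p ]= y → x ≡ y
  []=-functional here      here       = refl
  []=-functional (there h) (there h′) = []=-functional h h′

  []=-index : ∀ {xs : List A} {x} (x∈ : x ∈ xs) → xs [ toℕ (Any.index x∈) ]= x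
  []=-index (Any.here refl) = here
  []=-index (Any.there x∈)  = there ([]=-index x∈)

  []=-lookup : ∀ (xs : List A) i → xs [ toℕ i ]= lookup xs i
  []=-lookup (x ∷ xs) zero    = here
  []=-lookup (x ∷ xs) (suc i) = there ([]=-lookup xs i)

  Unique⇒[]=-injective : ∀ {xs : List A} {p q x} → Unique xs → xs [ p ]= x → xs [ q ]= x → p ≡ q
  Unique⇒[]=-injective _          here      here      = refl
  Unique⇒[]=-injective (x∉ ∷ _)   here      (there h) = ⊥-elim (All.lookup x∉ ([]=⇒∈ h) refl)
  Unique⇒[]=-injective (x∉ ∷ _)   (there h) here      = ⊥-elim (All.lookup x∉ ([]=⇒∈ h) refl)
  Unique⇒[]=-injective (_ ∷ uniq) (there h) (there h′) = cong suc (Unique⇒[]=-injective uniq h h′)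

  []=-map⁻ : ∀ {B : Set} (f : A → B) {xs p y} → map f xs [ p ]= y → ∃[ x ] xs [ p ]= x × f x ≡ y
  []=-map⁻ f {x ∷ xs} here      = x , here , refl
  []=-map⁻ f {x ∷ xs} (there h) with []=-map⁻ f h
  ... | z , h′ , eq = z , there h′ , eq

Unique-⊆⇒length≤ : ∀ {A : Set} {xs ys : List A} → Unique xs → xs ⊆ ys → length xs ≤ length ys
Unique-⊆⇒length≤ {xs = []}     _            _   = z≤n
Unique-⊆⇒length≤ {xs = x ∷ xs} (x∉ ∷ uniq) sub with ∈-∃++ (sub (Any.here refl))
... | as , bs , refl = begin
    suc (length xs)              ≤⟨ s≤s (Unique-⊆⇒length≤ uniq sub′) ⟩
    suc (length (as ++ bs))      ≡⟨ cong suc (length-++ as) ⟩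
    suc (length as + length bs)  ≡⟨ sym (+-suc (length as) (length bs)) ⟩
    length as + length (x ∷ bs)  ≡⟨ sym (length-++ as) ⟩
    length (as ++ x ∷ bs)        ∎
  where
  open ≤-Reasoning
  sub′ : xs ⊆ as ++ bs
  sub′ y∈ with ∈-++⁻ as (sub (Any.there y∈))
  ... | inj₁ y∈as             = ∈-++⁺ˡ y∈as
  ... | inj₂ (Any.here refl)  = ⊥-elim (All.lookup x∉ y∈ refl)
  ... | inj₂ (Any.there y∈bs) = ∈-++⁺ʳ as y∈bs

length≡1⇒∈-unique : ∀ {A : Set} {xs : List A} {x y} → length xs ≡ 1 → x ∈ xs → y ∈ xs → x ≡ y
length≡1⇒∈-unique {xs = _ ∷ []} _ (Any.here refl) (Any.here refl) = refl

-- The standard caterpillar and its layouts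

data Token : Set where
  spine : ℕ → Token
  leaf  : ℕ → ℕ → Token

infix 4 _⟶_

_⟶_ : Token → Token → Set
spine i  ⟶ spine j  = j ≡ suc i
spine i  ⟶ leaf j _ = i ≡ j
leaf _ _ ⟶ _        = ⊥

base : Token → ℕ
base (spine j)  = j
base (leaf j _) = j

Adjacent : Token → Token → Set
Adjacent t u = t ⟶ u ⊎ u ⟶ t

Adjacent-sym : ∀ {t u} → Adjacent t u → Adjacent u t
Adjacent-sym (inj₁ e) = inj₂ e
Adjacent-sym (inj₂ e) = inj₁ e

Adjacent-irrefl : ∀ t → ¬ Adjacent t t
Adjacent-irrefl (spine j) (inj₁ ())
Adjacent-irrefl (spine j) (inj₂ ())

spine-injective : ∀ {a b} → spine a ≡ spine b → a ≡ b
spine-injective refl = refl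

leaf-injective : ∀ {a b c d} → leaf a b ≡ leaf c d → a ≡ c × b ≡ d
leaf-injective refl = refl , refl

-- The token at position p of the list is to receive the label 2p + 1.
Admissible : List Token → Set
Admissible xs = ∀ {p q t u} → xs [ p ]= t → xs [ q ]= u → p < q → Adjacent t u → WellSpaced p q

Spine1First : List Token → Set
Spine1First xs = ∀ {p} → xs [ p ]= spine 1 → p ≡ 0

Arranged : List Token → Set
Arranged X = Admissible X × Spine1First X

module Blocks (k : ℕ → ℕ) where

  block : ℕ → List Token
  block j = spine j ∷ map (leaf j) (upTo (k j))

  blocks : ℕ → ℕ → List Token
  blocks j zero    = []
  blocks j (suc m) = block j ++ blocks (suc j) m

  Valid : Token → Set
  Valid (spine _)  = ⊤
  Valid (leaf j l) = l < k j

  ∈-block⁺ : ∀ t → Valid t → t ∈ block (base t)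
  ∈-block⁺ (spine j)  _   = Any.here refl
  ∈-block⁺ (leaf j l) l<k = Any.there (∈-map⁺ (leaf j) (∈-upTo⁺ l<k))

  ∈-block⁻ : ∀ {j t} → t ∈ block j → base t ≡ j × Valid t
  ∈-block⁻ (Any.here refl) = refl , tt
  ∈-block⁻ {j} (Any.there t∈) with ∈-map⁻ (leaf j) t∈
  ... | l , l∈ , refl = refl , ∈-upTo⁻ l∈

  ∈-blocks⁺ : ∀ j m t → j ≤ base t → base t < j + m → Valid t → t ∈ blocks j m
  ∈-blocks⁺ j zero    t j≤ <j+0 _ = ⊥-elim (<⇒≱ <j+0 (≤-trans (≤-reflexive (+-identityʳ j)) j≤))
  ∈-blocks⁺ j (suc m) t j≤ <j+m+1 valid with m≤n⇒m<n∨m≡n j≤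
  ... | inj₂ refl = ∈-++⁺ˡ (∈-block⁺ t valid)
  ... | inj₁ j<   = ∈-++⁺ʳ (block j) (∈-blocks⁺ (suc j) m t j< (subst (base t <_) (+-suc j m) <j+m+1) valid)

  ∈-blocks⁻ : ∀ j m {t} → t ∈ blocks j m → j ≤ base t × base t < j + m × Valid t
  ∈-blocks⁻ j (suc m) t∈ with ∈-++⁻ (block j) t∈
  ... | inj₁ t∈b with ∈-block⁻ t∈b
  ...   | refl , valid = ≤-refl , m<m+n j (s≤s z≤n) , valid
  ∈-blocks⁻ j (suc m) {t} t∈ | inj₂ t∈bs with ∈-blocks⁻ (suc j) m t∈bs
  ... | j<b , b< , valid = <⇒≤ j<b , subst (base t <_) (sym (+-suc j m)) b< , valid

  block-unique : ∀ j → Unique (block j)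
  block-unique j = All.tabulate spine∉ ∷ Unique.map⁺ (proj₂ ∘ leaf-injective) (Unique.upTo⁺ (k j))
    where
    spine∉ : ∀ {t} → t ∈ map (leaf j) (upTo (k j)) → spine j ≢ t
    spine∉ t∈ refl with ∈-map⁻ (leaf j) t∈
    ... | _ , _ , ()

  blocks-unique : ∀ j m → Unique (blocks j m)
  blocks-unique j zero    = []
  blocks-unique j (suc m) = Unique.++⁺ (block-unique j) (blocks-unique (suc j) m) disjoint
    where
    disjoint : ∀ {t} → t ∈ block j × t ∈ blocks (suc j) m → ⊥
    disjoint (t∈b , t∈bs) with ∈-block⁻ t∈b | ∈-blocks⁻ (suc j) m t∈bs
    ... | refl , _ | j< , _ = <-irrefl refl j<

-- The layout automaton

-- Relative to a current spine vertex i: spine+ d is spine (d + i), leaf+ d l is leaf (d + i) l,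
-- and spine₀ is the end vertex spine 0.
data RelToken : Set where
  spine+ : ℕ → RelToken
  leaf+  : ℕ → ℕ → RelToken
  spine₀ : RelToken

instantiate : ℕ → RelToken → Token
instantiate i (spine+ d)  = spine (d + i)
instantiate i (leaf+ d l) = leaf (d + i) l
instantiate i spine₀      = spine 0

edgeᵇ : RelToken → RelToken → Bool
edgeᵇ (spine+ d) (spine+ e)  = suc d ≡ᵇ e
edgeᵇ (spine+ d) (leaf+ e _) = d ≡ᵇ e
edgeᵇ _          _           = false

adjacentᵇ : RelToken → RelToken → Bool
adjacentᵇ t u = edgeᵇ t u ∨ edgeᵇ u t

instantiate-edge : ∀ {i} → 1 ≤ i → ∀ t u → instantiate i t ⟶ instantiate i u →
                   T (edgeᵇ t u) ⊎ instantiate i u ≡ spine 1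
instantiate-edge {i} _ (spine+ d) (spine+ e) eq = inj₁ (≡⇒≡ᵇ (suc d) e (sym (+-cancelʳ-≡ i e (suc d) eq)))
instantiate-edge {i} _ (spine+ d) (leaf+ e _) eq = inj₁ (≡⇒≡ᵇ d e (+-cancelʳ-≡ i d e eq))
instantiate-edge _ spine₀ (spine+ e) eq = inj₂ (cong spine eq)
instantiate-edge {i} 1≤i spine₀ (leaf+ e _) eq = ⊥-elim (<⇒≱ (≤-trans 1≤i (m≤n+m i e)) (≤-reflexive (sym eq)))

instantiate-adjacent : ∀ {i} → 1 ≤ i → ∀ t u → Adjacent (instantiate i t) (instantiate i u) →
                       T (adjacentᵇ t u) ⊎ instantiate i t ≡ spine 1 ⊎ instantiate i u ≡ spine 1
instantiate-adjacent 1≤i t u (inj₁ t⟶u) with instantiate-edge 1≤i t u t⟶u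
... | inj₁ e = inj₁ (from T-∨ (inj₁ e))
... | inj₂ e = inj₂ (inj₂ e)
instantiate-adjacent 1≤i t u (inj₂ u⟶t) with instantiate-edge 1≤i u t u⟶t
... | inj₁ e = inj₁ (from (T-∨ {edgeᵇ t u}) (inj₂ e))
... | inj₂ e = inj₂ (inj₁ e)

T-not-∨ : ∀ {b c} → T (not b ∨ c) → T b → T c
T-not-∨ {true} c _ = c

T-not : ∀ {b} → T (not b) → ¬ T b
T-not {false} _ ()

pow2ᵇ : ℕ → Bool
pow2ᵇ 1 = true
pow2ᵇ 2 = true
pow2ᵇ 4 = true
pow2ᵇ _ = false

pow2ᵇ-sound : ∀ d → T (pow2ᵇ d) → IsPow2 d
pow2ᵇ-sound 1 _ = 0 , refl
pow2ᵇ-sound 2 _ = 1 , refl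
pow2ᵇ-sound 4 _ = 2 , refl
pow2ᵇ-sound (suc (suc (suc (suc (suc _))))) ()

spacedFromᵇ : RelToken → ℕ → List RelToken → Bool
spacedFromᵇ x d []       = true
spacedFromᵇ x d (y ∷ ys) = (not (adjacentᵇ x y) ∨ pow2ᵇ d) ∧ spacedFromᵇ x (suc d) ys

spacedFromᵇ-sound : ∀ x d ys {q y} → T (spacedFromᵇ x d ys) → ys [ q ]= y → T (adjacentᵇ x y) → IsPow2 (d + q)
spacedFromᵇ-sound x d (y ∷ ys) ok here adj with adjacentᵇ x y | to (T-∧ {not (adjacentᵇ x y) ∨ pow2ᵇ d}) ok
... | true | ok-y , _ = subst IsPow2 (sym (+-identityʳ d)) (pow2ᵇ-sound d ok-y)
spacedFromᵇ-sound x d (y ∷ ys) {suc q} ok (there h) adj =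
  subst IsPow2 (sym (+-suc d q))
    (spacedFromᵇ-sound x (suc d) ys (proj₂ (to (T-∧ {not (adjacentᵇ x y) ∨ pow2ᵇ d}) ok)) h adj)

spacedᵇ : List RelToken → Bool
spacedᵇ []       = true
spacedᵇ (x ∷ xs) = spacedFromᵇ x 1 xs ∧ spacedᵇ xs

spacedᵇ-sound : ∀ xs {o o′ t u} → T (spacedᵇ xs) → xs [ o ]= t → xs [ o′ ]= u → o < o′ →
                T (adjacentᵇ t u) → IsPow2 (o′ ∸ o)
spacedᵇ-sound (x ∷ xs) ok here (there h) _ adj =
  spacedFromᵇ-sound x 1 xs (proj₁ (to (T-∧ {spacedFromᵇ x 1 xs}) ok)) h adj
spacedᵇ-sound (x ∷ xs) ok (there h) (there h′) (s≤s o<o′) adj =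
  spacedᵇ-sound xs (proj₂ (to (T-∧ {spacedFromᵇ x 1 xs}) ok)) h h′ o<o′ adj

isSpine+ᵇ : ℕ → RelToken → Bool
isSpine+ᵇ d (spine+ e) = d ≡ᵇ e
isSpine+ᵇ d _          = false

spineGapᵇ : ℕ → ℕ → List RelToken → Bool
spineGapᵇ d a []       = true
spineGapᵇ d a (y ∷ ys) = (not (isSpine+ᵇ d y) ∨ (a ≡ᵇ length (y ∷ ys))) ∧ spineGapᵇ d a ys

spineGapᵇ-sound : ∀ d a ys {q} → T (spineGapᵇ d a ys) → ys [ q ]= spine+ d → q + a ≡ length ys
spineGapᵇ-sound d a (y ∷ ys) ok here =
  ≡ᵇ⇒≡ a _ (T-not-∨ (proj₁ (to (T-∧ {not (isSpine+ᵇ d y) ∨ _}) ok)) (≡⇒≡ᵇ d d refl))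
spineGapᵇ-sound d a (y ∷ ys) ok (there h) =
  cong suc (spineGapᵇ-sound d a ys (proj₂ (to (T-∧ {not (isSpine+ᵇ d y) ∨ _}) ok)) h)

-- The tokens laid out while spine vertex i is current and its first r leaves are still owed.
Placed : ℕ → ℕ → Token → Set
Placed i r (spine j)  = 1 ≤ j × j ≤ i
Placed i r (leaf j l) = 1 ≤ j × (j < i ⊎ j ≡ i × r ≤ l)

placedᵇ : ℕ → ℕ → RelToken → Bool
placedᵇ d r (spine+ e)  = e ≤ᵇ d
placedᵇ d r (leaf+ e l) = (e <ᵇ d) ∨ ((e ≡ᵇ d) ∧ (r ≤ᵇ l))
placedᵇ d r spine₀      = false

placedᵇ-sound : ∀ {i} d r t → 1 ≤ i → T (placedᵇ d r t) → Placed (d + i) r (instantiate i t)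
placedᵇ-sound {i} d r (spine+ e) 1≤i ok = ≤-trans 1≤i (m≤n+m i e) , +-monoˡ-≤ i (≤ᵇ⇒≤ e d ok)
placedᵇ-sound {i} d r (leaf+ e l) 1≤i ok with to (T-∨ {e <ᵇ d}) ok
... | inj₁ e<d = ≤-trans 1≤i (m≤n+m i e) , inj₁ (+-monoˡ-< i (<ᵇ⇒< e d e<d))
... | inj₂ ok′ with to (T-∧ {e ≡ᵇ d}) ok′
... | e≡d , r≤l = ≤-trans 1≤i (m≤n+m i e) , inj₂ (cong (_+ i) (≡ᵇ⇒≡ e d e≡d) , ≤ᵇ⇒≤ r l r≤l)

¬placedᵇ-sound : ∀ {i} r t → T (not (placedᵇ 0 r t)) → ¬ Placed i r (instantiate i t)
¬placedᵇ-sound r (spine+ zero) () _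
¬placedᵇ-sound {i} r (spine+ (suc e)) _ (_ , le) = 1+n≰n (≤-trans (s≤s (m≤n+m i e)) le)
¬placedᵇ-sound {i} r (leaf+ e l) _ (_ , inj₁ lt) = n≮n i (≤-trans (s≤s (m≤n+m i e)) lt)
¬placedᵇ-sound r (leaf+ zero l) unplaced (_ , inj₂ (_ , r≤l)) = T-not unplaced (≤⇒≤ᵇ r≤l)
¬placedᵇ-sound {i} r (leaf+ (suc e) l) _ (_ , inj₂ (eq , _)) = 1+n≰n (≤-trans (s≤s (m≤n+m i e)) (≤-reflexive eq))
¬placedᵇ-sound r spine₀ _ (() , _)

Placed-mono : ∀ {i i′ r r′} t → i < i′ → Placed i r t → Placed i′ r′ t
Placed-mono (spine j)  i<i′ (1≤j , j≤i)                = 1≤j , ≤-trans j≤i (<⇒≤ i<i′)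
Placed-mono (leaf j l) i<i′ (1≤j , inj₁ j<i)          = 1≤j , inj₁ (<-trans j<i i<i′)
Placed-mono (leaf j l) i<i′ (1≤j , inj₂ (refl , _))   = 1≤j , inj₁ i<i′

placed-boundary : ∀ {i r} t u → Placed i r t → ¬ Placed i r u → Adjacent t u → t ≡ spine i ⊎ t ≡ spine 1
placed-boundary (spine j) (spine .(suc j)) (1≤j , j≤i) u∉ (inj₁ refl) with m≤n⇒m<n∨m≡n j≤i
... | inj₁ j<i = ⊥-elim (u∉ (s≤s z≤n , j<i))
... | inj₂ j≡i = inj₁ (cong spine j≡i)
placed-boundary (spine (suc zero)) (spine zero) _ _ (inj₂ refl) = inj₂ refl
placed-boundary (spine (suc (suc j))) (spine (suc j)) (_ , j≤i) u∉ (inj₂ refl) =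
  ⊥-elim (u∉ (s≤s z≤n , ≤-trans (n≤1+n (suc j)) j≤i))
placed-boundary (spine j) (leaf .j l) (1≤j , j≤i) u∉ (inj₁ refl) with m≤n⇒m<n∨m≡n j≤i
... | inj₁ j<i = ⊥-elim (u∉ (1≤j , inj₁ j<i))
... | inj₂ j≡i = inj₁ (cong spine j≡i)
placed-boundary (leaf j l) (spine .j) (1≤j , inj₁ j<i) u∉ (inj₂ refl) = ⊥-elim (u∉ (1≤j , <⇒≤ j<i))
placed-boundary (leaf j l) (spine .j) (1≤j , inj₂ (j≡i , _)) u∉ (inj₂ refl) =
  ⊥-elim (u∉ (1≤j , ≤-reflexive j≡i))

-- The current spine vertex is the last token laid out (flush, owing) or the second to last
-- (trailing); in phase owing its leaves 0 and 1 are still to be laid out.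
data Phase : Set where
  flush trailing owing : Phase

gap : Phase → ℕ
gap flush    = 1
gap trailing = 2
gap owing    = 1

owed : Phase → ℕ
owed owing = 2
owed _     = 0

record Invariant (P : List Token) (i : ℕ) (φ : Phase) : Set where
  field
    1≤i          : 1 ≤ i
    admissible   : Admissible P
    spine1-first : Spine1First P
    current      : ∀ {p} → P [ p ]= spine i → p + gap φ ≡ length P
    placed       : ∀ {p t} → P [ p ]= t → Placed i (owed φ) t

fitsᵇ : Phase → List RelToken → Bool
fitsᵇ φ cs = spacedᵇ cs ∧ (spacedFromᵇ (spine+ 0) (gap φ) cs ∧ all (not ∘ placedᵇ 0 (owed φ)) cs)

module Append {P i φ} (inv : Invariant P i φ) (cs : List RelToken) (fit : T (fitsᵇ φ cs)) where
  open Invariant inv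

  private
    Q : List Token
    Q = map (instantiate i) cs

    spaced-cs : T (spacedᵇ cs)
    spaced-cs = proj₁ (to (T-∧ {spacedᵇ cs}) fit)

    rest : T (spacedFromᵇ (spine+ 0) (gap φ) cs ∧ all (not ∘ placedᵇ 0 (owed φ)) cs)
    rest = proj₂ (to (T-∧ {spacedᵇ cs}) fit)

    spaced-current : T (spacedFromᵇ (spine+ 0) (gap φ) cs)
    spaced-current = proj₁ (to (T-∧ {spacedFromᵇ (spine+ 0) (gap φ) cs}) rest)

    fresh : All (T ∘ not ∘ placedᵇ 0 (owed φ)) cs
    fresh = all⁺ _ cs (proj₂ (to (T-∧ {spacedFromᵇ (spine+ 0) (gap φ) cs}) rest))

  unplaced : ∀ {o c} → cs [ o ]= c → ¬ Placed i (owed φ) (instantiate i c)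
  unplaced {c = c} h = ¬placedᵇ-sound (owed φ) c (All.lookup fresh ([]=⇒∈ h))

  not-spine1 : ∀ {o c} → cs [ o ]= c → instantiate i c ≢ spine 1
  not-spine1 h eq = unplaced h (subst (Placed i (owed φ)) (sym eq) (s≤s z≤n , 1≤i))

  append-spine1-first : Spine1First (P ++ Q)
  append-spine1-first h with []=-++⁻ P h
  ... | inj₁ h′ = spine1-first h′
  ... | inj₂ (_ , _ , h′) with []=-map⁻ (instantiate i) h′
  ... | _ , hc , eq = ⊥-elim (not-spine1 hc eq)

  append-admissible : Admissible (P ++ Q)
  append-admissible {p} {q} hp hq p<q adj with []=-++⁻ P hp | []=-++⁻ P hq
  ... | inj₁ hp′ | inj₁ hq′ = admissible hp′ hq′ p<q adj
  ... | inj₂ (o , refl , _) | inj₁ hq′ =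
    ⊥-elim (<-asym p<q (<-≤-trans ([]=⇒< hq′) (m≤m+n (length P) o)))
  ... | inj₂ (o , refl , hp′) | inj₂ (o′ , refl , hq′)
    with []=-map⁻ (instantiate i) hp′ | []=-map⁻ (instantiate i) hq′
  ... | c , hc , refl | c′ , hc′ , refl with instantiate-adjacent 1≤i c c′ adj
  ... | inj₁ adjᵇ = inj₂ (subst IsPow2 (sym ([m+n]∸[m+o]≡n∸o (length P) o′ o))
                      (spacedᵇ-sound cs spaced-cs hc hc′ (+-cancelˡ-< (length P) o o′ p<q) adjᵇ))
  ... | inj₂ (inj₁ eq) = ⊥-elim (not-spine1 hc eq)
  ... | inj₂ (inj₂ eq) = ⊥-elim (not-spine1 hc′ eq)
  append-admissible {p} {q} {t} hp hq p<q adj | inj₁ hp′ | inj₂ (o , refl , hq′)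
    with []=-map⁻ (instantiate i) hq′
  ... | c , hc , refl with placed-boundary t (instantiate i c) (placed hp′) (unplaced hc) adj
  ... | inj₂ refl = inj₁ (spine1-first hp′)
  ... | inj₁ refl with instantiate-adjacent 1≤i (spine+ 0) c adj
  ... | inj₁ adjᵇ = inj₂ (subst IsPow2 (sym distance) (spacedFromᵇ-sound (spine+ 0) (gap φ) cs spaced-current hc adjᵇ))
    where
    open ≡-Reasoning
    distance : (length P + o) ∸ p ≡ gap φ + o
    distance = begin
      (length P + o) ∸ p      ≡⟨ cong (λ n → (n + o) ∸ p) (sym (current hp′)) ⟩
      (p + gap φ + o) ∸ p     ≡⟨ cong (_∸ p) (+-assoc p (gap φ) o) ⟩
      (p + (gap φ + o)) ∸ p   ≡⟨ m+n∸m≡n p (gap φ + o) ⟩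
      gap φ + o               ∎
  ... | inj₂ (inj₁ eq) = inj₁ (spine1-first (subst (P [ p ]=_) eq hp′))
  ... | inj₂ (inj₂ eq) = ⊥-elim (not-spine1 hc eq)

infix 4 _⇒_

record Move : Set where
  constructor _⇒_
  field
    chunk : List RelToken
    next  : Phase
open Move

advancesᵇ : Phase → ℕ → Move → Bool
advancesᵇ φ d (cs ⇒ φ′) = fitsᵇ φ cs ∧ (all (placedᵇ d (owed φ′)) cs ∧ spineGapᵇ d (gap φ′) cs)

instantiate-spine : ∀ {i} c d → instantiate i c ≡ spine (suc d + i) → c ≡ spine+ (suc d)
instantiate-spine {i} (spine+ e) d eq = cong spine+ (+-cancelʳ-≡ i e (suc d) (spine-injective eq))

append-invariant : ∀ {P i φ} d mv → T (advancesᵇ φ (suc d) mv) → Invariant P i φ →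
                   Invariant (P ++ map (instantiate i) (chunk mv)) (suc d + i) (next mv)
append-invariant {P} {i} {φ} d (cs ⇒ φ′) ok inv = record
  { 1≤i          = s≤s z≤n
  ; admissible   = append-admissible
  ; spine1-first = append-spine1-first
  ; current      = current′
  ; placed       = placed′
  }
  where
  open Invariant inv
  fit : T (fitsᵇ φ cs)
  fit = proj₁ (to (T-∧ {fitsᵇ φ cs}) ok)
  rest : T (all (placedᵇ (suc d) (owed φ′)) cs ∧ spineGapᵇ (suc d) (gap φ′) cs)
  rest = proj₂ (to (T-∧ {fitsᵇ φ cs}) ok)
  placed-after : All (T ∘ placedᵇ (suc d) (owed φ′)) cs
  placed-after = all⁺ _ cs (proj₁ (to (T-∧ {all (placedᵇ (suc d) (owed φ′)) cs}) rest))
  gap-ok : T (spineGapᵇ (suc d) (gap φ′) cs)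
  gap-ok = proj₂ (to (T-∧ {all (placedᵇ (suc d) (owed φ′)) cs}) rest)
  open Append inv cs fit

  current′ : ∀ {p} → (P ++ map (instantiate i) cs) [ p ]= spine (suc d + i) →
             p + gap φ′ ≡ length (P ++ map (instantiate i) cs)
  current′ h with []=-++⁻ P h
  ... | inj₁ h′ = ⊥-elim (1+n≰n (≤-trans (s≤s (m≤n+m i d)) (proj₂ (placed h′))))
  ... | inj₂ (o , refl , h′) with []=-map⁻ (instantiate i) h′
  ... | c , hc , eq with instantiate-spine c d eq
  ... | refl = begin
    length P + o + gap φ′                    ≡⟨ +-assoc (length P) o (gap φ′) ⟩
    length P + (o + gap φ′)                  ≡⟨ cong (length P +_) (spineGapᵇ-sound (suc d) (gap φ′) cs gap-ok hc) ⟩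
    length P + length cs                     ≡⟨ cong (length P +_) (sym (length-map (instantiate i) cs)) ⟩
    length P + length (map (instantiate i) cs) ≡⟨ sym (length-++ P) ⟩
    length (P ++ map (instantiate i) cs)     ∎
    where open ≡-Reasoning

  placed′ : ∀ {p t} → (P ++ map (instantiate i) cs) [ p ]= t → Placed (suc d + i) (owed φ′) t
  placed′ {t = t} h with []=-++⁻ P h
  ... | inj₁ h′ = Placed-mono t (m<n+m i (s≤s z≤n)) (placed h′)
  ... | inj₂ (_ , _ , h′) with []=-map⁻ (instantiate i) h′
  ... | c , hc , refl = placedᵇ-sound (suc d) (owed φ′) c 1≤i (All.lookup placed-after ([]=⇒∈ hc))

owed₀ owed₁ : RelToken
owed₀ = leaf+ 0 0
owed₁ = leaf+ 0 1

flushMove : ℕ → Move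
flushMove 0 = spine+ 1 ∷ [] ⇒ flush
flushMove 1 = spine+ 1 ∷ leaf+ 1 0 ∷ [] ⇒ trailing
flushMove 2 = spine+ 1 ∷ [] ⇒ owing
flushMove _ = leaf+ 1 2 ∷ spine+ 1 ∷ [] ⇒ owing

trailingMove : ℕ → Move
trailingMove 0 = spine+ 1 ∷ [] ⇒ flush
trailingMove 1 = spine+ 1 ∷ leaf+ 1 0 ∷ [] ⇒ trailing
trailingMove 2 = spine+ 1 ∷ [] ⇒ owing
trailingMove _ = leaf+ 1 0 ∷ leaf+ 1 1 ∷ spine+ 1 ∷ leaf+ 1 2 ∷ [] ⇒ trailing

-- owingMove l is for a next spine vertex with suc l leaves.
owingMove : ℕ → Move
owingMove 0 = owed₀ ∷ owed₁ ∷ leaf+ 1 0 ∷ spine+ 1 ∷ [] ⇒ flush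
owingMove 1 = owed₀ ∷ owed₁ ∷ leaf+ 1 0 ∷ spine+ 1 ∷ leaf+ 1 1 ∷ [] ⇒ trailing
owingMove _ = owed₀ ∷ owed₁ ∷ leaf+ 1 2 ∷ spine+ 1 ∷ [] ⇒ owing

-- From phase owing, a leafless spine vertex i + 1 is laid out together with vertex i + 2.
skipMove : ℕ → Move
skipMove 0 = owed₀ ∷ spine+ 1 ∷ spine+ 2 ∷ owed₁ ∷ [] ⇒ trailing
skipMove 1 = owed₀ ∷ owed₁ ∷ leaf+ 2 0 ∷ spine+ 1 ∷ spine+ 2 ∷ [] ⇒ flush
skipMove 2 = owed₀ ∷ owed₁ ∷ leaf+ 2 0 ∷ spine+ 1 ∷ spine+ 2 ∷ leaf+ 2 1 ∷ [] ⇒ trailing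
skipMove _ = owed₀ ∷ owed₁ ∷ leaf+ 2 2 ∷ spine+ 1 ∷ spine+ 2 ∷ [] ⇒ owing

finish : Phase → List RelToken
finish owing = owed₀ ∷ owed₁ ∷ spine₀ ∷ []
finish _     = spine₀ ∷ []

finishSkip : List RelToken
finishSkip = owed₀ ∷ owed₁ ∷ spine₀ ∷ spine+ 1 ∷ []

flushMove-advances : ∀ k → T (advancesᵇ flush 1 (flushMove k))
flushMove-advances 0 = tt
flushMove-advances 1 = tt
flushMove-advances 2 = tt
flushMove-advances (suc (suc (suc _))) = tt

trailingMove-advances : ∀ k → T (advancesᵇ trailing 1 (trailingMove k))
trailingMove-advances 0 = tt
trailingMove-advances 1 = tt
trailingMove-advances 2 = tt
trailingMove-advances (suc (suc (suc _))) = tt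

owingMove-advances : ∀ l → T (advancesᵇ owing 1 (owingMove l))
owingMove-advances 0 = tt
owingMove-advances 1 = tt
owingMove-advances (suc (suc _)) = tt

skipMove-advances : ∀ k → T (advancesᵇ owing 2 (skipMove k))
skipMove-advances 0 = tt
skipMove-advances 1 = tt
skipMove-advances 2 = tt
skipMove-advances (suc (suc (suc _))) = tt

finish-fits : ∀ φ → T (fitsᵇ φ (finish φ))
finish-fits flush    = tt
finish-fits trailing = tt
finish-fits owing    = tt

_≟ᴿ_ : DecidableEquality RelToken
spine+ d  ≟ᴿ spine+ e  = map′ (cong spine+) (λ { refl → refl }) (d ≟ e)
leaf+ d l ≟ᴿ leaf+ e m = map′ (λ { (refl , refl) → refl }) (λ { refl → refl , refl }) (d ≟ e ×-dec l ≟ m)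
spine₀    ≟ᴿ spine₀    = yes refl
spine+ _  ≟ᴿ leaf+ _ _ = no λ ()
spine+ _  ≟ᴿ spine₀    = no λ ()
leaf+ _ _ ≟ᴿ spine+ _  = no λ ()
leaf+ _ _ ≟ᴿ spine₀    = no λ ()
spine₀    ≟ᴿ spine+ _  = no λ ()
spine₀    ≟ᴿ leaf+ _ _ = no λ ()

remove : RelToken → List RelToken → Maybe (List RelToken)
remove x []       = nothing
remove x (y ∷ ys) with x ≟ᴿ y
... | yes _ = just ys
... | no  _ = Maybe.map (y ∷_) (remove x ys)

remove-↭ : ∀ x ys {zs} → remove x ys ≡ just zs → ys ↭ x ∷ zs
remove-↭ x (y ∷ ys) eq with x ≟ᴿ y
remove-↭ x (x ∷ ys) refl | yes refl = ↭-refl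
... | no _ with remove x ys in removed
remove-↭ x (y ∷ ys) refl | no _ | just zs = ↭-trans (prep y (remove-↭ x ys removed)) (swap y x ↭-refl)

permutesᵇ : List RelToken → List RelToken → Bool
permutesᵇ []       []      = true
permutesᵇ []       (_ ∷ _) = false
permutesᵇ (x ∷ xs) ys      = maybe (permutesᵇ xs) false (remove x ys)

permutesᵇ-sound : ∀ xs ys → T (permutesᵇ xs ys) → xs ↭ ys
permutesᵇ-sound []       []  _  = ↭-refl
permutesᵇ-sound (x ∷ xs) ys ok with remove x ys in removed
... | just zs = ↭-trans (prep x (permutesᵇ-sound xs zs ok)) (↭-sym (remove-↭ x ys removed))

owedR : Phase → ℕ → List RelToken
owedR owing d = leaf+ d 0 ∷ leaf+ d 1 ∷ []
owedR _     d = []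

owedTokens : Phase → ℕ → List Token
owedTokens φ i = map (instantiate i) (owedR φ 0)

owedR-instantiate : ∀ φ d i → map (instantiate i) (owedR φ d) ≡ owedTokens φ (d + i)
owedR-instantiate flush    d i = refl
owedR-instantiate trailing d i = refl
owedR-instantiate owing    d i = refl

relBlock : ℕ → ℕ → List RelToken
relBlock d c = spine+ d ∷ map (leaf+ d) (upTo c)

relBlock-instantiate : ∀ i d c → map (instantiate i) (relBlock d c) ≡ spine (d + i) ∷ map (leaf (d + i)) (upTo c)
relBlock-instantiate i d c = cong (spine (d + i) ∷_) (sym (map-∘ (upTo c)))

balancedᵇ : Phase → ℕ → Move → List RelToken → Bool
balancedᵇ φ d (cs ⇒ φ′) blk = permutesᵇ (cs ++ owedR φ′ d) (owedR φ 0 ++ blk)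

flushMove-balanced : ∀ c → c ≤ 3 → T (balancedᵇ flush 1 (flushMove c) (relBlock 1 c))
flushMove-balanced 0 _ = tt
flushMove-balanced 1 _ = tt
flushMove-balanced 2 _ = tt
flushMove-balanced 3 _ = tt
flushMove-balanced (suc (suc (suc (suc _)))) (s≤s (s≤s (s≤s ())))

trailingMove-balanced : ∀ c → c ≤ 3 → T (balancedᵇ trailing 1 (trailingMove c) (relBlock 1 c))
trailingMove-balanced 0 _ = tt
trailingMove-balanced 1 _ = tt
trailingMove-balanced 2 _ = tt
trailingMove-balanced 3 _ = tt
trailingMove-balanced (suc (suc (suc (suc _)))) (s≤s (s≤s (s≤s ())))

owingMove-balanced : ∀ l → suc l ≤ 3 → T (balancedᵇ owing 1 (owingMove l) (relBlock 1 (suc l)))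
owingMove-balanced 0 _ = tt
owingMove-balanced 1 _ = tt
owingMove-balanced 2 _ = tt
owingMove-balanced (suc (suc (suc _))) (s≤s (s≤s (s≤s ())))

skipMove-balanced : ∀ c → c ≤ 3 → T (balancedᵇ owing 2 (skipMove c) (relBlock 1 0 ++ relBlock 2 c))
skipMove-balanced 0 _ = tt
skipMove-balanced 1 _ = tt
skipMove-balanced 2 _ = tt
skipMove-balanced 3 _ = tt
skipMove-balanced (suc (suc (suc (suc _)))) (s≤s (s≤s (s≤s ())))

module Arrangement (k : ℕ → ℕ) where
  open Blocks k
  open import Data.List.Relation.Binary.Permutation.Setoid.Properties (setoid Token) using (Unique-resp-↭)

  mutual
    arrange : Phase → ℕ → ℕ → List Token
    arrange φ        i zero    = map (instantiate i) (finish φ)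
    arrange flush    i (suc m) = perform 0 (flushMove (k (suc i))) i m
    arrange trailing i (suc m) = perform 0 (trailingMove (k (suc i))) i m
    arrange owing    i (suc m) = arrangeOwing i (k (suc i)) m

    arrangeOwing : ℕ → ℕ → ℕ → List Token
    arrangeOwing i zero    zero    = map (instantiate i) finishSkip
    arrangeOwing i zero    (suc m) = perform 1 (skipMove (k (2 + i))) i m
    arrangeOwing i (suc l) m       = perform 0 (owingMove l) i m

    -- perform d lays out a move that makes spine vertex suc d + i the current one.
    perform : ℕ → Move → ℕ → ℕ → List Token
    perform d (cs ⇒ φ) i m = map (instantiate i) cs ++ arrange φ (suc d + i) m

  append-arranged : ∀ {P i φ} cs → T (fitsᵇ φ cs) → Invariant P i φ → Arranged (P ++ map (instantiate i) cs)
  append-arranged cs fit inv = append-admissible , append-spine1-first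
    where open Append inv cs fit

  perform-arranged : ∀ {P i φ} d mv m → T (advancesᵇ φ (suc d) mv) → Invariant P i φ →
                     (∀ {P′} → Invariant P′ (suc d + i) (next mv) →
                               Arranged (P′ ++ arrange (next mv) (suc d + i) m)) →
                     Arranged (P ++ perform d mv i m)
  perform-arranged {P} {i} d (cs ⇒ φ′) m ok inv rest =
    subst Arranged (++-assoc P (map (instantiate i) cs) _) (rest (append-invariant d (cs ⇒ φ′) ok inv))

  mutual
    arrange-arranged : ∀ φ i m {P} → Invariant P i φ → Arranged (P ++ arrange φ i m)
    arrange-arranged φ i zero inv = append-arranged (finish φ) (finish-fits φ) inv
    arrange-arranged flush i (suc m) inv =
      perform-arranged 0 (flushMove (k (suc i))) m (flushMove-advances (k (suc i))) inv (arrange-arranged _ _ m)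
    arrange-arranged trailing i (suc m) inv =
      perform-arranged 0 (trailingMove (k (suc i))) m (trailingMove-advances (k (suc i))) inv (arrange-arranged _ _ m)
    arrange-arranged owing i (suc m) inv = arrangeOwing-arranged i (k (suc i)) m inv

    arrangeOwing-arranged : ∀ i l m {P} → Invariant P i owing → Arranged (P ++ arrangeOwing i l m)
    arrangeOwing-arranged i zero zero inv = append-arranged finishSkip tt inv
    arrangeOwing-arranged i zero (suc m) inv =
      perform-arranged 1 (skipMove (k (2 + i))) m (skipMove-advances (k (2 + i))) inv (arrange-arranged _ _ m)
    arrangeOwing-arranged i (suc l) m inv =
      perform-arranged 0 (owingMove l) m (owingMove-advances l) inv (arrange-arranged _ _ m)

  layout : ℕ → List Token
  layout zero    = spine 0 ∷ []
  layout (suc n) = spine 1 ∷ arrange flush 1 n ++ map (leaf 1) (upTo (k 1))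

  initial-invariant : Invariant (spine 1 ∷ []) 1 flush
  initial-invariant = record
    { 1≤i          = s≤s z≤n
    ; admissible   = λ { here here () _ ; here (there ()) _ _ ; (there ()) _ _ _ }
    ; spine1-first = λ { here → refl ; (there ()) }
    ; current      = λ { here → refl ; (there ()) }
    ; placed       = λ { here → s≤s z≤n , s≤s z≤n ; (there ()) }
    }

  -- The leaves of spine 1 can go anywhere after position 0, since their only neighbour sits there.
  append-spine1-leaves : ∀ X ls → Arranged X → Admissible (X ++ map (leaf 1) ls)
  append-spine1-leaves X ls (adm , first) {p} {q} {t} hp hq p<q adj with []=-++⁻ X hp | []=-++⁻ X hq
  ... | inj₁ hp′ | inj₁ hq′ = adm hp′ hq′ p<q adj
  ... | inj₂ (o , refl , _) | inj₁ hq′ = ⊥-elim (<-asym p<q (<-≤-trans ([]=⇒< hq′) (m≤m+n (length X) o)))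
  ... | inj₂ (_ , _ , hp′) | inj₂ (_ , _ , hq′) with []=-map⁻ (leaf 1) hp′ | []=-map⁻ (leaf 1) hq′
  ... | _ , _ , refl | _ , _ , refl with adj
  ... | inj₁ ()
  ... | inj₂ ()
  append-spine1-leaves X ls (adm , first) {p} {q} {t} hp hq p<q adj | inj₁ hp′ | inj₂ (_ , _ , hq′)
    with []=-map⁻ (leaf 1) hq′
  ... | _ , _ , refl with t | adj
  ... | spine .1 | inj₁ refl = inj₁ (first hp′)

  layout-admissible : ∀ n → Admissible (layout n)
  layout-admissible zero here here () _
  layout-admissible zero here (there ()) _ _
  layout-admissible zero (there ()) _ _ _
  layout-admissible (suc n) =
    append-spine1-leaves (spine 1 ∷ arrange flush 1 n) (upTo (k 1)) (arrange-arranged flush 1 n initial-invariant)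

  module _ (k≤3 : ∀ j → k j ≤ 3) where

    perform-↭ : ∀ {φ} d mv blk i m → T (balancedᵇ φ (suc d) mv blk) →
                map (instantiate i) blk ++ blocks (suc (suc d + i)) m ≡ blocks (suc i) (suc d + m) →
                arrange (next mv) (suc d + i) m
                  ↭ owedTokens (next mv) (suc d + i) ++ (blocks (suc (suc d + i)) m ++ spine 0 ∷ []) →
                perform d mv i m ↭ owedTokens φ i ++ (blocks (suc i) (suc d + m) ++ spine 0 ∷ [])
    perform-↭ {φ} d (cs ⇒ φ′) blk i m ok blk-eq rest = begin
        I cs ++ arrange φ′ (suc d + i) m
      ↭⟨ ++⁺ˡ (I cs) rest ⟩
        I cs ++ (owedTokens φ′ (suc d + i) ++ B ++ F)
      ≡⟨ cong (λ xs → I cs ++ (xs ++ B ++ F)) (sym (owedR-instantiate φ′ (suc d) i)) ⟩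
        I cs ++ (I (owedR φ′ (suc d)) ++ B ++ F)
      ≡⟨ sym (++-assoc (I cs) (I (owedR φ′ (suc d))) (B ++ F)) ⟩
        (I cs ++ I (owedR φ′ (suc d))) ++ B ++ F
      ≡⟨ cong (_++ B ++ F) (sym (map-++ (instantiate i) cs (owedR φ′ (suc d)))) ⟩
        I (cs ++ owedR φ′ (suc d)) ++ B ++ F
      ↭⟨ ++⁺ʳ (B ++ F) (↭.map⁺ (instantiate i) (permutesᵇ-sound (cs ++ owedR φ′ (suc d)) _ ok)) ⟩
        I (owedR φ 0 ++ blk) ++ B ++ F
      ≡⟨ cong (_++ B ++ F) (map-++ (instantiate i) (owedR φ 0) blk) ⟩
        (owedTokens φ i ++ I blk) ++ B ++ F
      ≡⟨ ++-assoc (owedTokens φ i) (I blk) (B ++ F) ⟩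
        owedTokens φ i ++ I blk ++ B ++ F
      ≡⟨ cong (owedTokens φ i ++_) (trans (sym (++-assoc (I blk) B F)) (cong (_++ F) blk-eq)) ⟩
        owedTokens φ i ++ blocks (suc i) (suc d + m) ++ F
      ∎
      where
      open PermutationReasoning
      I : List RelToken → List Token
      I = map (instantiate i)
      B F : List Token
      B = blocks (suc (suc d + i)) m
      F = spine 0 ∷ []

    single-block : ∀ i m → map (instantiate i) (relBlock 1 (k (suc i))) ++ blocks (2 + i) m ≡ blocks (suc i) (suc m)
    single-block i m = cong (_++ blocks (2 + i) m) (relBlock-instantiate i 1 (k (suc i)))

    mutual
      arrange-↭ : ∀ φ i m → arrange φ i m ↭ owedTokens φ i ++ (blocks (suc i) m ++ spine 0 ∷ [])
      arrange-↭ flush    i zero = ↭-refl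
      arrange-↭ trailing i zero = ↭-refl
      arrange-↭ owing    i zero = ↭-refl
      arrange-↭ flush i (suc m) =
        perform-↭ {flush} 0 (flushMove (k (suc i))) (relBlock 1 (k (suc i))) i m
          (flushMove-balanced _ (k≤3 (suc i))) (single-block i m) (arrange-↭ _ _ m)
      arrange-↭ trailing i (suc m) =
        perform-↭ {trailing} 0 (trailingMove (k (suc i))) (relBlock 1 (k (suc i))) i m
          (trailingMove-balanced _ (k≤3 (suc i))) (single-block i m) (arrange-↭ _ _ m)
      arrange-↭ owing i (suc m) = arrangeOwing-↭ i (k (suc i)) refl m

      arrangeOwing-↭ : ∀ i l → l ≡ k (suc i) → ∀ m →
                       arrangeOwing i l m ↭ owedTokens owing i ++ (blocks (suc i) (suc m) ++ spine 0 ∷ [])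
      arrangeOwing-↭ i zero k≡0 zero rewrite sym k≡0 = prep _ (prep _ (swap _ _ ↭-refl))
      arrangeOwing-↭ i zero k≡0 (suc m) =
        perform-↭ {owing} 1 (skipMove (k (2 + i))) (relBlock 1 0 ++ relBlock 2 (k (2 + i))) i m
          (skipMove-balanced _ (k≤3 (2 + i))) two-blocks (arrange-↭ _ _ m)
        where
        two-blocks : map (instantiate i) (relBlock 1 0 ++ relBlock 2 (k (2 + i))) ++ blocks (3 + i) m
                     ≡ blocks (suc i) (2 + m)
        two-blocks rewrite sym k≡0 =
          cong (λ xs → spine (suc i) ∷ xs ++ blocks (3 + i) m) (relBlock-instantiate i 2 (k (2 + i)))
      arrangeOwing-↭ i (suc l) k≡l+1 m =
        perform-↭ {owing} 0 (owingMove l) (relBlock 1 (suc l)) i m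
          (owingMove-balanced l (subst (_≤ 3) (sym k≡l+1) (k≤3 (suc i))))
          (subst (λ c → map (instantiate i) (relBlock 1 c) ++ blocks (2 + i) m ≡ blocks (suc i) (suc m))
                 (sym k≡l+1) (single-block i m))
          (arrange-↭ _ _ m)

    layout-↭ : k 0 ≡ 0 → ∀ n → layout n ↭ blocks 0 (suc n)
    layout-↭ k0≡0 zero rewrite k0≡0 = ↭-refl
    layout-↭ k0≡0 (suc n) rewrite k0≡0 = begin
        spine 1 ∷ arrange flush 1 n ++ L₁
      ↭⟨ prep (spine 1) (++⁺ʳ L₁ (arrange-↭ flush 1 n)) ⟩
        spine 1 ∷ (blocks 2 n ++ spine 0 ∷ []) ++ L₁
      ≡⟨ cong (spine 1 ∷_) (++-assoc (blocks 2 n) (spine 0 ∷ []) L₁) ⟩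
        spine 1 ∷ blocks 2 n ++ spine 0 ∷ L₁
      ↭⟨ prep (spine 1) (shift (spine 0) (blocks 2 n) L₁) ⟩
        spine 1 ∷ spine 0 ∷ blocks 2 n ++ L₁
      ↭⟨ swap (spine 1) (spine 0) (++-comm (blocks 2 n) L₁) ⟩
        spine 0 ∷ spine 1 ∷ L₁ ++ blocks 2 n
      ∎
      where
      open PermutationReasoning
      L₁ : List Token
      L₁ = map (leaf 1) (upTo (k 1))

    layout-unique : k 0 ≡ 0 → ∀ n → Unique (layout n)
    layout-unique k0≡0 n = Unique-resp-↭ (↭⇒↭ₛ (↭-sym (layout-↭ k0≡0 n))) (blocks-unique 0 (suc n))

-- From layouts to labelings

module LayoutLabeling {G : Graph} {encode : Fin (N G) → Token} {L : List Token}
  (encode-injective : Injective _≡_ _≡_ encode)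
  (L-unique : Unique L)
  (encode∈L : ∀ v → encode v ∈ L)
  (L⊆image : ∀ {t} → t ∈ L → ∃[ v ] encode v ≡ t)
  (encode-adjacent : ∀ u v → Adj G u v → Adjacent (encode u) (encode v))
  (L-admissible : Admissible L)
  where

  position : Fin (N G) → Fin (length L)
  position v = Any.index (encode∈L v)

  at-position : ∀ v → L [ toℕ (position v) ]= encode v
  at-position v = []=-index (encode∈L v)

  position-injective : Injective _≡_ _≡_ position
  position-injective {u} {v} eq =
    encode-injective ([]=-functional (at-position u) (subst (λ p → L [ toℕ p ]= encode v) (sym eq) (at-position v)))

  vertexAt : Fin (length L) → Fin (N G)
  vertexAt p = proj₁ (L⊆image (∈-lookup p))

  position-vertexAt : ∀ p → position (vertexAt p) ≡ p
  position-vertexAt p with L⊆image (∈-lookup {xs = L} p)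
  ... | v , encode-v≡ = toℕ-injective
    (Unique⇒[]=-injective L-unique (at-position v) (subst (L [ toℕ p ]=_) (sym encode-v≡) ([]=-lookup L p)))

  N≡length : N G ≡ length L
  N≡length = ≤-antisym (injective⇒≤ position-injective) (injective⇒≤ vertexAt-injective)
    where
    vertexAt-injective : Injective _≡_ _≡_ vertexAt
    vertexAt-injective {p} {q} eq = trans (sym (position-vertexAt p)) (trans (cong position eq) (position-vertexAt q))

  label : Fin (N G) → Fin (N G)
  label = cast (sym N≡length) ∘ position

  toℕ-label : ∀ v → toℕ (label v) ≡ toℕ (position v)
  toℕ-label v = toℕ-cast (sym N≡length) (position v)

  label-injective : Injective _≡_ _≡_ label
  label-injective {u} {v} eq =
    position-injective (toℕ-injective (trans (sym (toℕ-label u)) (trans (cong toℕ eq) (toℕ-label v))))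

  label-coprime : ∀ u v → Adj G u v → Coprime (oddLabel (label u)) (oddLabel (label v))
  label-coprime u v adj rewrite toℕ-label u | toℕ-label v with <-cmp (toℕ (position u)) (toℕ (position v))
  ... | tri< p<q _ _ = wellSpaced-coprime p<q (L-admissible (at-position u) (at-position v) p<q (encode-adjacent u v adj))
  ... | tri> _ _ q<p = coprime-sym (wellSpaced-coprime q<p
                         (L-admissible (at-position v) (at-position u) q<p (Adjacent-sym (encode-adjacent u v adj))))
  ... | tri≈ _ p≡q _ = ⊥-elim (Adjacent-irrefl (encode u)
                         (subst (Adjacent (encode u)) (sym encode-u≡encode-v) (encode-adjacent u v adj)))
    where
    encode-u≡encode-v : encode u ≡ encode v
    encode-u≡encode-v = []=-functional (at-position u) (subst (L [_]= encode v) (sym p≡q) (at-position v))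

  label-surjective : Surjective _≡_ _≡_ label
  label-surjective y = vertexAt (cast N≡length y) , λ { refl → toℕ-injective (begin
    toℕ (label (vertexAt (cast N≡length y)))      ≡⟨ toℕ-label _ ⟩
    toℕ (position (vertexAt (cast N≡length y)))   ≡⟨ cong toℕ (position-vertexAt _) ⟩
    toℕ (cast N≡length y)                         ≡⟨ toℕ-cast N≡length y ⟩
    toℕ y                                         ∎) }
    where open ≡-Reasoning

  odd-prime-labeling : OddPrimeLabeling G
  odd-prime-labeling = label , (label-injective , label-surjective) , label-coprime

-- Caterpillar graphs

module _ (G : Graph) where

  Adj-sym : ∀ {u v} → Adj G u v → Adj G v u
  Adj-sym {u} {v} uv = trans (Graph.sym G v u) uv

  Adj-irrefl : ∀ {v} → ¬ Adj G v v
  Adj-irrefl {v} vv with trans (sym vv) (irrefl G v)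
  ... | ()

  neighbours : Fin (N G) → List (Fin (N G))
  neighbours v = filterᵇ (adj G v) (allFin (N G))

  ∈-neighbours⁺ : ∀ {v u} → Adj G v u → u ∈ neighbours v
  ∈-neighbours⁺ {v} {u} vu = ∈-filter⁺ (T? ∘ adj G v) (∈-allFin u) (from T-≡ vu)

  degree-one⇒unique-neighbour : ∀ {w a b} → degree G w ≡ 1 → Adj G w a → Adj G w b → a ≡ b
  degree-one⇒unique-neighbour deg wa wb = length≡1⇒∈-unique deg (∈-neighbours⁺ wa) (∈-neighbours⁺ wb)

  distinct-neighbours≤degree : ∀ {v xs} → Unique xs → (∀ {u} → u ∈ xs → Adj G v u) → length xs ≤ degree G v
  distinct-neighbours≤degree uniq adj = Unique-⊆⇒length≤ uniq (∈-neighbours⁺ ∘ adj)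

module SpineFacts {G : Graph} (acyclic : Acyclic G) (P : Spine G) where
  open Spine P

  clamp : ℕ → Fin (suc n)
  clamp j with j ≤? n
  ... | yes j≤n = fromℕ< (s≤s j≤n)
  ... | no  _   = fromℕ n

  toℕ-clamp : ∀ {j} → j ≤ n → toℕ (clamp j) ≡ j
  toℕ-clamp {j} j≤n with j ≤? n
  ... | yes j≤n′ = toℕ-fromℕ< (s≤s j≤n′)
  ... | no  j≰n  = ⊥-elim (j≰n j≤n)

  clamp-toℕ : ∀ i → clamp (toℕ i) ≡ i
  clamp-toℕ i = toℕ-injective (toℕ-clamp (toℕ≤pred[n] i))

  spineAt : ℕ → Fin (N G)
  spineAt j = s (clamp j)

  spineAt-toℕ : ∀ i → spineAt (toℕ i) ≡ s i
  spineAt-toℕ i = cong s (clamp-toℕ i)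

  spineAt-injective : ∀ {a b} → a ≤ n → b ≤ n → spineAt a ≡ spineAt b → a ≡ b
  spineAt-injective {a} {b} a≤n b≤n eq = trans (sym (toℕ-clamp a≤n)) (trans (cong toℕ (inj eq)) (toℕ-clamp b≤n))

  spineAt-adjacent : ∀ j → suc j ≤ n → Adj G (spineAt j) (spineAt (suc j))
  spineAt-adjacent j j<n = subst₂ (Adj G) (cong s from-left) (cong s from-right) (consec e)
    where
    e : Fin n
    e = fromℕ< j<n
    from-left : inject₁ e ≡ clamp j
    from-left = toℕ-injective (trans (toℕ-inject₁ e) (trans (toℕ-fromℕ< j<n) (sym (toℕ-clamp (<⇒≤ j<n)))))
    from-right : suc e ≡ clamp (suc j)
    from-right = toℕ-injective (trans (cong suc (toℕ-fromℕ< j<n)) (sym (toℕ-clamp j<n)))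

  -- A chord from spine vertex a to spine vertex a + d + 2 closes the cycle a, a + 1, …, a + d + 2.
  no-chord : ∀ a d → a + suc (suc d) ≤ n → ¬ Adj G (spineAt a) (spineAt (a + suc (suc d)))
  no-chord a d bound chord = acyclic (record
    { k = d ; c = c ; inj = c-injective ; consec = c-consec ; close = c-close })
    where
    c : Fin (3 + d) → Fin (N G)
    c m = spineAt (a + toℕ m)
    in-range : ∀ (m : Fin (3 + d)) → a + toℕ m ≤ n
    in-range m = ≤-trans (+-monoʳ-≤ a (toℕ≤pred[n] m)) bound
    c-injective : ∀ {x y} → c x ≡ c y → x ≡ y
    c-injective {x} {y} eq = toℕ-injective (+-cancelˡ-≡ a _ _ (spineAt-injective (in-range x) (in-range y) eq))
    c-consec : ∀ (i : Fin (2 + d)) → Adj G (c (inject₁ i)) (c (suc i))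
    c-consec i rewrite toℕ-inject₁ i | +-suc a (toℕ i) =
      spineAt-adjacent (a + toℕ i)
        (≤-trans (≤-reflexive (sym (+-suc a (toℕ i)))) (≤-trans (+-monoʳ-≤ a (s≤s (toℕ≤pred[n] i))) bound))
    c-close : Adj G (c (fromℕ (2 + d))) (c zero)
    c-close rewrite toℕ-fromℕ (2 + d) | +-identityʳ a = Adj-sym G chord

  chord-free : ∀ a b → a < b → b ≤ n → Adj G (spineAt a) (spineAt b) → b ≡ suc a
  chord-free a b a<b b≤n ab with m≤n⇒∃[o]m+o≡n a<b
  ... | zero  , eq   = trans (sym eq) (+-identityʳ (suc a))
  ... | suc d , refl = ⊥-elim (no-chord a d (≤-trans (≤-reflexive (+-suc a (suc d))) b≤n)
                         (subst (λ b → Adj G (spineAt a) (spineAt b)) (sym (+-suc a (suc d))) ab))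

  spine-adjacent : ∀ i j → Adj G (s i) (s j) → toℕ j ≡ suc (toℕ i) ⊎ toℕ i ≡ suc (toℕ j)
  spine-adjacent i j ij with <-cmp (toℕ i) (toℕ j)
  ... | tri< i<j _ _ = inj₁ (chord-free _ _ i<j (toℕ≤pred[n] j)
                         (subst₂ (Adj G) (sym (spineAt-toℕ i)) (sym (spineAt-toℕ j)) ij))
  ... | tri≈ _ i≡j _ rewrite toℕ-injective i≡j = ⊥-elim (Adj-irrefl G ij)
  ... | tri> _ _ j<i = inj₂ (chord-free _ _ j<i (toℕ≤pred[n] i)
                         (subst₂ (Adj G) (sym (spineAt-toℕ j)) (sym (spineAt-toℕ i)) (Adj-sym G ij)))

module CaterpillarEncoding {G : Graph} (acyclic : Acyclic G) (P : Spine G)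
  (hanging : ∀ v → (∀ i → ¬ (Spine.s P i ≡ v)) →
             degree G v ≡ 1 × ∃ λ i → Interior P i × Adj G (Spine.s P i) v)
  (max5 : maxDegree≤ G 5)
  where
  open Spine P
  open SpineFacts acyclic P

  OnSpine : Fin (N G) → Set
  OnSpine v = ∃[ i ] s i ≡ v

  onSpine? : ∀ v → Dec (OnSpine v)
  onSpine? v = any? (λ i → s i ≟ᶠ v)

  module _ {v} (off : ¬ OnSpine v) where
    private
      hang : degree G v ≡ 1 × ∃ λ i → Interior P i × Adj G (s i) v
      hang = hanging v (λ i e → off (i , e))

    parent : Fin (suc n)
    parent = proj₁ (proj₂ hang)

    parent-interior : Interior P parent
    parent-interior = proj₁ (proj₂ (proj₂ hang))

    parent-adjacent : Adj G (s parent) v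
    parent-adjacent = proj₂ (proj₂ (proj₂ hang))

    the-neighbour : ∀ {u} → Adj G v u → s parent ≡ u
    the-neighbour vu = degree-one⇒unique-neighbour G (proj₁ hang) (Adj-sym G parent-adjacent) vu

    parent-unique : ∀ c → Adj G (s c) v → parent ≡ c
    parent-unique c cv = inj (the-neighbour (Adj-sym G cv))

  Hangs : Fin (suc n) → Fin (N G) → Set
  Hangs c v = Adj G (s c) v × ¬ OnSpine v

  hangs? : ∀ c → Decidable (Hangs c)
  hangs? c v = (adj G (s c) v Bool.≟ true) ×-dec ¬? (onSpine? v)

  leavesAt : Fin (suc n) → List (Fin (N G))
  leavesAt c = filter (hangs? c) (allFin (N G))

  ∈-leavesAt⁺ : ∀ {c v} → Hangs c v → v ∈ leavesAt c
  ∈-leavesAt⁺ {c} {v} h = ∈-filter⁺ (hangs? c) (∈-allFin v) h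

  ∈-leavesAt⁻ : ∀ {c v} → v ∈ leavesAt c → Hangs c v
  ∈-leavesAt⁻ {c} v∈ = proj₂ (∈-filter⁻ (hangs? c) {xs = allFin (N G)} v∈)

  leavesAt-unique : ∀ c → Unique (leavesAt c)
  leavesAt-unique c = Unique.filter⁺ (hangs? c) (Unique.allFin⁺ (N G))

  leavesAt-noninterior : ∀ c → ¬ Interior P c → leavesAt c ≡ []
  leavesAt-noninterior c ¬int with leavesAt c | ∈-leavesAt⁻ {c}
  ... | []    | _     = refl
  ... | v ∷ _ | hangs with hangs (Any.here refl)
  ... | cv , off = ⊥-elim (¬int (subst (Interior P) (parent-unique off c cv) (parent-interior off)))

  interior-leaves≤3 : ∀ j → 0 < j → j < n → length (leavesAt (clamp j)) ≤ 3
  interior-leaves≤3 (suc a) _ j<n =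
    ≤-pred (≤-pred (≤-trans (distinct-neighbours≤degree G distinct adjacent) (max5 _)))
    where
    a<n : a < n
    a<n = <-trans (n<1+n a) j<n
    before after : Fin (N G)
    before = spineAt a
    after  = spineAt (2 + a)
    before≢after : before ≢ after
    before≢after eq with spineAt-injective (<⇒≤ a<n) j<n eq
    ... | ()
    off-spine : ∀ {c x} → x ∈ leavesAt c → ∀ i → spineAt i ≢ x
    off-spine x∈ i refl = proj₂ (∈-leavesAt⁻ x∈) (clamp i , refl)
    distinct : Unique (before ∷ after ∷ leavesAt (clamp (suc a)))
    distinct = (before≢after All.∷ All.tabulate (λ x∈ → off-spine x∈ a))
             ∷ All.tabulate (λ x∈ → off-spine x∈ (2 + a)) ∷ leavesAt-unique _
    adjacent : ∀ {x} → x ∈ before ∷ after ∷ leavesAt (clamp (suc a)) → Adj G (spineAt (suc a)) x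
    adjacent (Any.here refl)             = Adj-sym G (spineAt-adjacent a (<⇒≤ j<n))
    adjacent (Any.there (Any.here refl)) = spineAt-adjacent (suc a) j<n
    adjacent (Any.there (Any.there x∈))  = proj₁ (∈-leavesAt⁻ x∈)

  leaves≤3 : ∀ c → length (leavesAt c) ≤ 3
  leaves≤3 c with 0 <? toℕ c ×-dec toℕ c <? n
  ... | yes (0<c , c<n) =
    subst (λ c → length (leavesAt c) ≤ 3) (clamp-toℕ c) (interior-leaves≤3 (toℕ c) 0<c c<n)
  ... | no ¬int         = subst (λ xs → length xs ≤ 3) (sym (leavesAt-noninterior c ¬int)) z≤n

  -- Beyond n, clamp returns the end vertex n, which has no leaves.
  leafCount : ℕ → ℕ
  leafCount j = length (leavesAt (clamp j))

  leafCount≤3 : ∀ j → leafCount j ≤ 3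
  leafCount≤3 j = leaves≤3 (clamp j)

  leafCount-0 : leafCount 0 ≡ 0
  leafCount-0 =
    cong length (leavesAt-noninterior (clamp 0) λ (0<c , _) → <-irrefl (sym (toℕ-clamp z≤n)) 0<c)

  rank : ∀ {v} (off : ¬ OnSpine v) → Fin (length (leavesAt (parent off)))
  rank off = Any.index (∈-leavesAt⁺ (parent-adjacent off , off))

  at-rank : ∀ {v} (off : ¬ OnSpine v) → leavesAt (parent off) [ toℕ (rank off) ]= v
  at-rank off = []=-index (∈-leavesAt⁺ (parent-adjacent off , off))

  encodeWith : ∀ v → Dec (OnSpine v) → Token
  encodeWith v (yes (i , _)) = spine (toℕ i)
  encodeWith v (no off)      = leaf (toℕ (parent off)) (toℕ (rank off))

  encode : Fin (N G) → Token
  encode v = encodeWith v (onSpine? v)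

  encode-spine : ∀ i → encode (s i) ≡ spine (toℕ i)
  encode-spine i with onSpine? (s i)
  ... | yes (i′ , e) = cong (spine ∘ toℕ) (inj e)
  ... | no off       = ⊥-elim (off (i , refl))

  encode-leaf : ∀ c {l v} → leavesAt c [ l ]= v → encode v ≡ leaf (toℕ c) l
  encode-leaf c {l} {v} v-at with onSpine? v | ∈-leavesAt⁻ ([]=⇒∈ v-at)
  ... | yes on | _ , off = ⊥-elim (off on)
  ... | no off | cv , _  = cong₂ leaf (cong toℕ parent≡c)
        (Unique⇒[]=-injective (leavesAt-unique c)
          (subst (λ c → leavesAt c [ toℕ (rank off) ]= v) parent≡c (at-rank off)) v-at)
    where
    parent≡c : parent off ≡ c
    parent≡c = parent-unique off c cv

  encode-injective : ∀ {u v} → encode u ≡ encode v → u ≡ v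
  encode-injective {u} {v} eq with onSpine? u | onSpine? v
  ... | yes (i , refl) | yes (j , refl) = cong s (toℕ-injective (spine-injective eq))
  ... | no offu | no offv with leaf-injective eq
  ... | p≡p , r≡r = []=-functional (subst (λ c → leavesAt c [ toℕ (rank offu) ]= u) parents (at-rank offu))
                                   (subst (leavesAt (parent offv) [_]= v) (sym r≡r) (at-rank offv))
    where
    parents : parent offu ≡ parent offv
    parents = toℕ-injective p≡p

  encode-adjacent : ∀ u v → Adj G u v → Adjacent (encode u) (encode v)
  encode-adjacent u v uv with onSpine? u | onSpine? v
  ... | yes (i , refl) | yes (j , refl) = spine-adjacent i j uv
  ... | yes (i , refl) | no off = inj₁ (cong toℕ (sym (parent-unique off i uv)))
  ... | no off | yes (j , refl) = inj₂ (cong toℕ (sym (parent-unique off j (Adj-sym G uv))))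
  ... | no offu | no offv = ⊥-elim (offv (parent offu , the-neighbour offu uv))

  open Blocks leafCount

  encode∈blocks : ∀ v → encode v ∈ blocks 0 (suc n)
  encode∈blocks v with onSpine? v
  ... | yes (i , _) = ∈-blocks⁺ 0 (suc n) (spine (toℕ i)) z≤n (s≤s (toℕ≤pred[n] i)) tt
  ... | no off      =
    ∈-blocks⁺ 0 (suc n) (leaf (toℕ (parent off)) (toℕ (rank off))) z≤n (s≤s (toℕ≤pred[n] (parent off)))
      (subst (λ c → toℕ (rank off) < length (leavesAt c)) (sym (clamp-toℕ (parent off))) (toℕ<n (rank off)))

  blocks⊆image : ∀ {t} → t ∈ blocks 0 (suc n) → ∃[ v ] encode v ≡ t
  blocks⊆image {t} t∈ with ∈-blocks⁻ 0 (suc n) t∈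
  blocks⊆image {spine j}  _ | _ , s≤s j≤n , _ =
    spineAt j , trans (encode-spine (clamp j)) (cong spine (toℕ-clamp j≤n))
  blocks⊆image {leaf j l} _ | _ , s≤s j≤n , l<k =
    lookup (leavesAt (clamp j)) (fromℕ< l<k) ,
    trans (encode-leaf (clamp j) ([]=-lookup _ (fromℕ< l<k))) (cong₂ leaf (toℕ-clamp j≤n) (toℕ-fromℕ< l<k))

mainTheorem13 : (G : Graph) → Caterpillar G → maxDegree≤ G 5 → OddPrime G
mainTheorem13 G ((_ , _ , acyclic) , P , hanging) max5 = odd-prime-labeling
  where
  open Spine P using (n)
  open CaterpillarEncoding acyclic P hanging max5
  open Blocks leafCount using (blocks)
  open Arrangement leafCount

  layout≈blocks : layout n ↭ blocks 0 (suc n)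
  layout≈blocks = layout-↭ leafCount≤3 leafCount-0 n

  open LayoutLabeling {G} {encode} {layout n}
    encode-injective
    (layout-unique leafCount≤3 leafCount-0 n)
    (λ v → ∈-resp-↭ (↭-sym layout≈blocks) (encode∈blocks v))
    (λ t∈ → blocks⊆image (∈-resp-↭ layout≈blocks t∈))
    encode-adjacent
    (layout-admissible n)
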